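{- Let $A$ be an incomplete symmetric $n\times n$ matrix. Then $A$ is Strong-Robinsonian if and only if $A$ has a Robinsonian completion.
   Context: An $n\times n$ symmetric matrix $A=(a_{i,j})$ with real entries is \emph{incomplete} if some of its entries are missing; a missing entry is written $a_{i,j}=*$ (symmetry means $a_{i,j}=a_{j,i}$, including that $a_{i,j}=*$ iff $a_{j,i}=*$). $A$ is \emph{Strong-Robinson} if $a_{i,j}\le a_{k,l}$ for all $i\le k\le l\le j$ such that $a_{i,j}\neq *\neq a_{k,l}$. For a permutation $\pi$ of $\{1,\dots,n\}$, $A_\pi$ is the matrix with entries $a_{\pi(i),\pi(j)}$. $A$ is \emph{Strong-Robinsonian} if there is a permutation $\pi$ such that $A_\pi$ is Strong-Robinson. A complete (no missing entries) symmetric matrix is \emph{Robinson} if $a_{i,j}\le \min\{a_{i,j-1},a_{i+1,j}\}$ for all $1\le i<j\le n$ (equivalently, entries do not decrease along rows and columns moving toward the main diagonal), and \emph{Robinsonian} if some $A_\pi$ is Robinson. A \emph{completion} of $A$ is an assignment of real values to all missing entries of $A$ (keeping symmetry); the completion is \emph{Robinsonian} if the resulting complete matrix is Robinsonian.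
   Formalization: The entries of $A$ and the values assigned to missing entries by a completion are taken in ℚ instead of the real numbers. -}

module Defs where

open import Data.Nat using (ℕ; suc)
open import Data.Fin using (Fin; toℕ)
import Data.Fin as F
open import Data.Fin.Permutation using (Permutation′; _⟨$⟩ʳ_)
open import Data.Maybe using (Maybe; just)
open import Data.Rational using (ℚ; _≤_)
open import Data.Product using (Σ; ∃; _×_)
open import Relation.Binary.PropositionalEquality using (_≡_)

-- An incomplete n×n matrix: an entry is either 'just x' (known) or
-- 'nothing' (missing, written * in the paper).
IncMatrix : ℕ → Set
IncMatrix n = Fin n → Fin n → Maybe ℚ

Matrix : ℕ → Set
Matrix n = Fin n → Fin n → ℚ

SymmetricInc : ∀ {n} → IncMatrix n → Set
SymmetricInc A = ∀ i j → A i j ≡ A j i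

Symmetric : ∀ {n} → Matrix n → Set
Symmetric M = ∀ i j → M i j ≡ M j i

permuteInc : ∀ {n} → Permutation′ n → IncMatrix n → IncMatrix n
permuteInc π A i j = A (π ⟨$⟩ʳ i) (π ⟨$⟩ʳ j)

permute : ∀ {n} → Permutation′ n → Matrix n → Matrix n
permute π M i j = M (π ⟨$⟩ʳ i) (π ⟨$⟩ʳ j)

StrongRobinson : ∀ {n} → IncMatrix n → Set
StrongRobinson A = ∀ i j k l → i F.≤ k → k F.≤ l → l F.≤ j →
  ∀ x y → A i j ≡ just x → A k l ≡ just y → x ≤ y

StrongRobinsonian : ∀ {n} → IncMatrix n → Set
StrongRobinsonian A = ∃ λ π → StrongRobinson (permuteInc π A)

-- a_{i,j} ≤ min{a_{i,j-1}, a_{i+1,j}} for all i < j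
-- (j' plays the role of j-1, i' the role of i+1)
Robinson : ∀ {n} → Matrix n → Set
Robinson M =
  (∀ i j j' → i F.< j → toℕ j ≡ suc (toℕ j') → M i j ≤ M i j') ×
  (∀ i i' j → i F.< j → toℕ i' ≡ suc (toℕ i) → M i j ≤ M i' j)

Robinsonian : ∀ {n} → Matrix n → Set
Robinsonian M = ∃ λ π → Robinson (permute π M)

IsCompletion : ∀ {n} → IncMatrix n → Matrix n → Set
IsCompletion A M = Symmetric M × (∀ i j x → A i j ≡ just x → M i j ≡ x)

HasRobinsonianCompletion : ∀ {n} → IncMatrix n → Set
HasRobinsonianCompletion A = ∃ λ M → IsCompletion A M × Robinsonian M

{-# OPTIONS --safe #-}
-- Along the rows and columns of a Robinson matrix the entries grow step by step towards
-- the diagonal, so chaining the steps gives m_{i,j} ≤ m_{k,l} whenever [k,l] ⊆ [i,j]; hence a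
-- Robinson completion of A_π makes A_π Strong-Robinson.
-- Conversely, if A_π is Strong-Robinson, complete it by its upper envelope: entry (i,j)
-- becomes the largest known a_{k,l} with i, j ∈ [k,l], where missing entries and the empty
-- case are replaced by a lower bound of all known entries. Shrinking [i,j] admits more
-- intervals [k,l], so the envelope is Robinson; and for a known a_{i,j} with i ≤ j every
-- admitted a_{k,l} has [i,j] ⊆ [k,l], so it is at most a_{i,j} by Strong-Robinsonness.
module Submission where

open import Defs
open import Data.Nat using (ℕ; zero; suc; _+_; _∸_; s≤s)
import Data.Nat.Properties as ℕ
open import Data.Fin using (Fin; toℕ; inject₁)
import Data.Fin as F
open import Data.Fin.Properties using (toℕ-inject₁; toℕ-injective; _≤?_; ≤-total)
open import Data.Fin.Permutation
  using (Permutation′; flip; _⟨$⟩ʳ_; _⟨$⟩ˡ_; inverseˡ; inverseʳ)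
open import Data.List using (List; map; filter; cartesianProduct; allFin)
import Data.List.Extrema as Extrema
open import Data.List.Membership.Propositional using (_∈_; lose)
open import Data.List.Membership.Propositional.Properties
  using (∈-map⁺; ∈-map⁻; ∈-filter⁺; ∈-filter⁻; ∈-cartesianProduct⁺; ∈-allFin)
import Data.List.Relation.Binary.Subset.Propositional.Properties as Subset
import Data.List.Relation.Unary.All as All
open import Data.Maybe using (Maybe; just; nothing; fromMaybe)
open import Data.Rational using (ℚ; _≤_; _≥_; 0ℚ)
import Data.Rational.Properties as ℚ
open import Data.Product using (_×_; _,_; swap)
open import Data.Sum using (inj₁; inj₂)
open import Function using (id; _⇔_; mk⇔)
open import Level using (0ℓ)
open import Relation.Binary using (Rel; Reflexive; Transitive; DecTotalOrder)
open import Relation.Binary.PropositionalEquality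
open import Relation.Nullary.Decidable using (_×-dec_)
open import Relation.Unary using (Pred; Decidable) renaming (_⊆_ to _⋐_)

open Extrema (DecTotalOrder.totalOrder ℚ.≤-decTotalOrder)
  using (max; min; max≤v⁺; v≤max⁺; min≤xs; max-mono-⊆)

module _ {ℓ₁ ℓ₂} {A : Set ℓ₁} {_≲_ : Rel A ℓ₂}
         (≲-refl : Reflexive _≲_) (≲-trans : Transitive _≲_)
         {n} (f : Fin n → A) {lo hi : Fin n}
         (step : ∀ a b → lo F.≤ a → b F.≤ hi → toℕ b ≡ suc (toℕ a) → f a ≲ f b) where

  private
    gap-induction : ∀ d {a b} → toℕ b ≡ d + toℕ a → lo F.≤ a → b F.≤ hi → f a ≲ f b
    gap-induction zero eq _ _ rewrite toℕ-injective eq = ≲-refl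
    gap-induction (suc d) {b = F.zero} ()
    gap-induction (suc d) {a} {F.suc b} eq lo≤a b≤hi =
      ≲-trans (gap-induction d eq′ lo≤a (ℕ.≤-trans b′≤b b≤hi))
              (step (inject₁ b) (F.suc b) lo≤b′ b≤hi (cong suc (sym (toℕ-inject₁ b))))
      where
      eq′ : toℕ (inject₁ b) ≡ d + toℕ a
      eq′ = trans (toℕ-inject₁ b) (ℕ.suc-injective eq)
      b′≤b : inject₁ b F.≤ F.suc b
      b′≤b = ℕ.m≤n⇒m≤1+n (ℕ.≤-reflexive (toℕ-inject₁ b))
      lo≤b′ : lo F.≤ inject₁ b
      lo≤b′ = ℕ.≤-trans lo≤a (ℕ.≤-trans (ℕ.m≤n+m (toℕ a) d) (ℕ.≤-reflexive (sym eq′)))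

  stepwise⇒monotone : ∀ {a b} → lo F.≤ a → a F.≤ b → b F.≤ hi → f a ≲ f b
  stepwise⇒monotone {a} {b} lo≤a a≤b =
    gap-induction (toℕ b ∸ toℕ a) (sym (ℕ.m∸n+n≡m a≤b)) lo≤a

Robinson⇒nested-≤ : ∀ {n} {M : Matrix n} → Robinson M →
                    ∀ {i j k l} → i F.≤ k → k F.≤ l → l F.≤ j → M i j ≤ M k l
Robinson⇒nested-≤ {M = M} (leftward , downward) {i} {j} {k} {l} i≤k k≤l l≤j =
  ℚ.≤-trans along-row along-column
  where
  along-row : M i j ≤ M i l
  along-row =
    stepwise⇒monotone {_≲_ = _≥_} ℚ.≤-refl (λ y≤x z≤y → ℚ.≤-trans z≤y y≤x) (M i)
      {lo = i} {hi = j}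
      (λ a b i≤a _ b≡1+a →
         leftward i b a (ℕ.≤-trans (s≤s i≤a) (ℕ.≤-reflexive (sym b≡1+a))) b≡1+a)
      (ℕ.≤-trans i≤k k≤l) l≤j ℕ.≤-refl
  along-column : M i l ≤ M k l
  along-column =
    stepwise⇒monotone {_≲_ = _≤_} ℚ.≤-refl ℚ.≤-trans (λ r → M r l)
      {lo = i} {hi = l}
      (λ a b _ b≤l b≡1+a →
         downward a b l (ℕ.≤-trans (ℕ.≤-reflexive (sym b≡1+a)) b≤l) b≡1+a)
      ℕ.≤-refl i≤k k≤l

robinsonCompletion⇒StrongRobinson : ∀ {n} {A : IncMatrix n} {M : Matrix n} →
                                    IsCompletion A M → Robinson M → StrongRobinson A
robinsonCompletion⇒StrongRobinson (_ , extends) rob i j k l i≤k k≤l l≤j x y Aij≡x Akl≡y =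
  subst₂ _≤_ (extends i j x Aij≡x) (extends k l y Akl≡y) (Robinson⇒nested-≤ rob i≤k k≤l l≤j)

Interval : ℕ → Set
Interval n = Fin n × Fin n

_∈ᴵ_ : ∀ {n} → Fin n → Interval n → Set
i ∈ᴵ (k , l) = k F.≤ i × i F.≤ l

∈ᴵ-convex : ∀ {n} {i j m : Fin n} (I : Interval n) →
            i ∈ᴵ I → j ∈ᴵ I → i F.≤ m → m F.≤ j → m ∈ᴵ I
∈ᴵ-convex _ (k≤i , _) (_ , j≤l) i≤m m≤j = ℕ.≤-trans k≤i i≤m , ℕ.≤-trans m≤j j≤l

Covers : ∀ {n} → Fin n → Fin n → Pred (Interval n) 0ℓ
Covers i j I = i ∈ᴵ I × j ∈ᴵ I

covers? : ∀ {n} (i j : Fin n) → Decidable (Covers i j)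
covers? i j (k , l) = ((k ≤? i) ×-dec (i ≤? l)) ×-dec ((k ≤? j) ×-dec (j ≤? l))

intervals : ∀ n → List (Interval n)
intervals n = cartesianProduct (allFin n) (allFin n)

∈-intervals : ∀ {n} (I : Interval n) → I ∈ intervals n
∈-intervals (k , l) = ∈-cartesianProduct⁺ (∈-allFin k) (∈-allFin l)

fromMaybe-≤ : ∀ {c y : ℚ} (m : Maybe ℚ) →
              c ≤ y → (∀ z → m ≡ just z → z ≤ y) → fromMaybe c m ≤ y
fromMaybe-≤ nothing  c≤y _      = c≤y
fromMaybe-≤ (just z) _   z≤y = z≤y z refl

module Envelope {n} (B : IncMatrix n) where

  entryOr : ℚ → Interval n → ℚ
  entryOr c (k , l) = fromMaybe c (B k l)

  known∈entries : ∀ c {k l x} {Is : List (Interval n)} →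
                  B k l ≡ just x → (k , l) ∈ Is → x ∈ map (entryOr c) Is
  known∈entries c Bkl≡x kl∈Is = subst (_∈ _) (cong (fromMaybe c) Bkl≡x) (∈-map⁺ (entryOr c) kl∈Is)

  floor : ℚ
  floor = min 0ℚ (map (entryOr 0ℚ) (intervals n))

  floor-≤ : ∀ {k l x} → B k l ≡ just x → floor ≤ x
  floor-≤ {k} {l} Bkl≡x = All.lookup (min≤xs 0ℚ _) (known∈entries 0ℚ Bkl≡x (∈-intervals (k , l)))

  coveringEntries : Fin n → Fin n → List ℚ
  coveringEntries i j = map (entryOr floor) (filter (covers? i j) (intervals n))

  envelope : Matrix n
  envelope i j = max floor (coveringEntries i j)

  envelope-mono : ∀ {i j i′ j′} → Covers i j ⋐ Covers i′ j′ → envelope i j ≤ envelope i′ j′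
  envelope-mono {i} {j} {i′} {j′} sub =
    max-mono-⊆ {xs = coveringEntries i j} {ys = coveringEntries i′ j′} ℚ.≤-refl
      (Subset.map⁺ _ (Subset.filter⁺′ (covers? i j) (covers? i′ j′) sub {intervals n} id))

  envelope-symmetric : Symmetric envelope
  envelope-symmetric i j = ℚ.≤-antisym (envelope-mono swap) (envelope-mono swap)

  envelope-robinson : Robinson envelope
  envelope-robinson = leftward , downward
    where
    leftward : ∀ i j j′ → i F.< j → toℕ j ≡ suc (toℕ j′) → envelope i j ≤ envelope i j′
    leftward i j j′ i<j j≡1+j′ = envelope-mono λ {I} (i∈I , j∈I) →
      i∈I , ∈ᴵ-convex I i∈I j∈I (ℕ.≤-pred (ℕ.≤-trans i<j (ℕ.≤-reflexive j≡1+j′)))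
                               (ℕ.≤-trans (ℕ.n≤1+n (toℕ j′)) (ℕ.≤-reflexive (sym j≡1+j′)))
    downward : ∀ i i′ j → i F.< j → toℕ i′ ≡ suc (toℕ i) → envelope i j ≤ envelope i′ j
    downward i i′ j i<j i′≡1+i = envelope-mono λ {I} (i∈I , j∈I) →
      ∈ᴵ-convex I i∈I j∈I (ℕ.≤-trans (ℕ.n≤1+n (toℕ i)) (ℕ.≤-reflexive (sym i′≡1+i)))
                          (ℕ.≤-trans (ℕ.≤-reflexive i′≡1+i) i<j) , j∈I

  envelope-extends-≤ : StrongRobinson B →
                       ∀ {i j x} → i F.≤ j → B i j ≡ just x → envelope i j ≡ x
  envelope-extends-≤ sr {i} {j} {x} i≤j Bij≡x =
    ℚ.≤-antisym (max≤v⁺ (floor-≤ Bij≡x) (All.tabulate bounded))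
                (v≤max⁺ floor _ (inj₂ (lose x∈ ℚ.≤-refl)))
    where
    bounded : ∀ {v} → v ∈ coveringEntries i j → v ≤ x
    bounded v∈ with ∈-map⁻ (entryOr floor) v∈
    ... | (k , l) , kl∈ , refl with ∈-filter⁻ (covers? i j) {xs = intervals n} kl∈
    ... | _ , (k≤i , _) , (_ , j≤l) =
      fromMaybe-≤ (B k l) (floor-≤ Bij≡x) (λ y Bkl≡y → sr k l i j k≤i i≤j j≤l y x Bkl≡y Bij≡x)
    x∈ : x ∈ coveringEntries i j
    x∈ = known∈entries floor Bij≡x
           (∈-filter⁺ (covers? i j) (∈-intervals (i , j)) ((ℕ.≤-refl , i≤j) , (i≤j , ℕ.≤-refl)))

  envelope-completion : SymmetricInc B → StrongRobinson B → IsCompletion B envelope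
  envelope-completion symB sr = envelope-symmetric , extends
    where
    extends : ∀ i j x → B i j ≡ just x → envelope i j ≡ x
    extends i j x Bij≡x with ≤-total i j
    ... | inj₁ i≤j = envelope-extends-≤ sr i≤j Bij≡x
    ... | inj₂ j≤i =
      trans (envelope-symmetric i j) (envelope-extends-≤ sr j≤i (trans (symB j i) Bij≡x))

Robinson-resp : ∀ {n} {M N : Matrix n} → (∀ i j → M i j ≡ N i j) → Robinson M → Robinson N
Robinson-resp M≗N (leftward , downward) =
  (λ i j j′ i<j j≡1+j′ → subst₂ _≤_ (M≗N i j) (M≗N i j′) (leftward i j j′ i<j j≡1+j′)) ,
  (λ i i′ j i<j i′≡1+i → subst₂ _≤_ (M≗N i j) (M≗N i′ j) (downward i i′ j i<j i′≡1+i))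

permuteInc-symmetric : ∀ {n} (π : Permutation′ n) {A : IncMatrix n} →
                       SymmetricInc A → SymmetricInc (permuteInc π A)
permuteInc-symmetric π symA i j = symA (π ⟨$⟩ʳ i) (π ⟨$⟩ʳ j)

permute-flip : ∀ {n} (π : Permutation′ n) (M : Matrix n) i j →
               permute π (permute (flip π) M) i j ≡ M i j
permute-flip π M i j = cong₂ M (inverseˡ π) (inverseˡ π)

IsCompletion-permute : ∀ {n} (π : Permutation′ n) {A : IncMatrix n} {M : Matrix n} →
                       IsCompletion A M → IsCompletion (permuteInc π A) (permute π M)
IsCompletion-permute π (symM , extends) =
  (λ i j → symM (π ⟨$⟩ʳ i) (π ⟨$⟩ʳ j)) , (λ i j → extends (π ⟨$⟩ʳ i) (π ⟨$⟩ʳ j))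

IsCompletion-unpermute : ∀ {n} (π : Permutation′ n) {A : IncMatrix n} {M : Matrix n} →
                         IsCompletion (permuteInc π A) M → IsCompletion A (permute (flip π) M)
IsCompletion-unpermute π {A} (symM , extends) =
  (λ i j → symM (π ⟨$⟩ˡ i) (π ⟨$⟩ˡ j)) ,
  (λ i j x Aij≡x →
     extends (π ⟨$⟩ˡ i) (π ⟨$⟩ˡ j) x (trans (cong₂ A (inverseʳ π) (inverseʳ π)) Aij≡x))

lemma1 : (n : ℕ) (A : IncMatrix n) → SymmetricInc A →
    (StrongRobinsonian A ⇔ HasRobinsonianCompletion A)
lemma1 _ A symA = mk⇔ completion strongRobinson
  where
  completion : StrongRobinsonian A → HasRobinsonianCompletion A
  completion (π , sr) =
    permute (flip π) envelope ,
    IsCompletion-unpermute π (envelope-completion (permuteInc-symmetric π symA) sr) ,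
    π , Robinson-resp (λ i j → sym (permute-flip π envelope i j)) envelope-robinson
    where open Envelope (permuteInc π A)

  strongRobinson : HasRobinsonianCompletion A → StrongRobinsonian A
  strongRobinson (M , completes , π , rob) =
    π , robinsonCompletion⇒StrongRobinson (IsCompletion-permute π completes) rob
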